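{- Let $L$ be the BWT of $T$, with runs starting at positions $\ell(1)<\ell(2)<\cdots<\ell(r)$ and $\ell(r+1)=n+1$, let $\mathcal{S}_{\mathsf{start}}=\{\ell(1),\dots,\ell(r)\}$, and let $L'=L[\ell(1)]L[\ell(2)]\cdots L[\ell(r)]$. For an interval $[b,e]\subseteq\{1,\dots,n\}$ let $b'=\mathsf{rank}(\mathcal{S}_{\mathsf{start}},b)$ and $e'=\mathsf{rank}(\mathcal{S}_{\mathsf{start}},e)$. Then $$\mathsf{RD}(L,b,e)=\{(c,\max\{\ell(p),b\},\min\{\ell(q+1)-1,e\}) \mid (c,p,q)\in\mathsf{RD}(L',b',e')\}.$$
   Context: $T$ is a string of length $n\ge 2$ over $\Sigma=\{1,\dots,\sigma\}$ ending with a special character $\$$ not occurring elsewhere, every character of $\Sigma$ occurring in $T$. The suffix array $\mathsf{SA}$ sorts the suffixes of $T$ lexicographically; $\mathsf{LF}(i)$ is the position with $\mathsf{SA}[\mathsf{LF}(i)]=\mathsf{SA}[i]-1$ (or $=n$ if $\mathsf{SA}[i]=1$); the BWT is $L[i]=T[\mathsf{SA}[\mathsf{LF}(i)]]$. The runs of $L$: $r=1+|\{i\in\{2,\dots,n\}: L[i]\neq L[i-1]\}|$, $\ell(1)=1$, $\ell(r+1)=n+1$, and for $j\in\{2,\dots,r\}$, $\ell(j)=\min\{i>\ell(j-1): L[i]\neq L[i-1]\}$. For a set $S$ of integers, $\mathsf{rank}(S,i)=|\{j\in S: j\le i\}|$. For a string $S$, $\mathit{Occ}(S,c)$ is the set of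 positions of character $c$ in $S$, and the range distinct query $\mathsf{RD}(S,b,e)=\{(c,p_c,q_c) \mid c \text{ occurs in } S[b..e]\}$ with $p_c=\min(\mathit{Occ}(S,c)\cap[b,e])$, $q_c=\max(\mathit{Occ}(S,c)\cap[b,e])$. -}

module Defs where

open import Data.Nat using (ℕ; zero; suc; _+_; _∸_; _≤_; _<_; _≟_; _≤?_; _⊔_; _⊓_)
open import Data.Product using (Σ; _×_; _,_; ∃)
open import Data.Bool using (Bool; true; false; if_then_else_)
open import Data.List using (List; []; _∷_; length; filter)
open import Relation.Nullary using (¬_; does)
open import Relation.Binary.PropositionalEquality using (_≡_; _≢_)

-- Strings are 1-indexed functions ℕ → ℕ; only positions 1..len matter.
-- The end marker $ is encoded as the character 0 (smaller than all of Σ = {1..σ}).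

record ValidText (σ n : ℕ) (T : ℕ → ℕ) : Set where
  field
    n≥2     : 2 ≤ n
    end$    : T n ≡ 0
    inΣ     : ∀ i → 1 ≤ i → i < n → 1 ≤ T i × T i ≤ σ
    allOccur : ∀ c → 1 ≤ c → c ≤ σ → ∃ λ i → 1 ≤ i × i < n × T i ≡ c

SufLt : (n : ℕ) → (ℕ → ℕ) → ℕ → ℕ → Set
SufLt n T i j = ∃ λ k → i + k ≤ n × j + k ≤ n
  × (∀ m → m < k → T (i + m) ≡ T (j + m)) × T (i + k) < T (j + k)

-- SA is the suffix array of T: it maps [1,n] into [1,n] and lists the
-- suffixes in strictly increasing lexicographic order (hence it is a bijection).
record IsSA (n : ℕ) (T : ℕ → ℕ) (SA : ℕ → ℕ) : Set where
  field
    range  : ∀ i → 1 ≤ i → i ≤ n → 1 ≤ SA i × SA i ≤ n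
    sorted : ∀ i j → 1 ≤ i → i < j → j ≤ n → SufLt n T (SA i) (SA j)

BWT : ℕ → (ℕ → ℕ) → (ℕ → ℕ) → ℕ → ℕ
BWT n T SA i with SA i ≟ 1
... | Relation.Nullary.yes _ = T n
... | Relation.Nullary.no  _ = T (SA i ∸ 1)

search : (ℕ → ℕ) → ℕ → ℕ → ℕ
search L zero    k = k
search L (suc f) k = if does (L k ≟ L (k ∸ 1)) then search L f (suc k) else k

-- min{ i > p : i ≤ n, L[i] ≠ L[i-1] }, or n+1 if none
nextChange : (ℕ → ℕ) → ℕ → ℕ → ℕ
nextChange L n p = search L (n ∸ p) (suc p)

-- run heads ℓ(1) = 1, ℓ(j+1) = nextChange(ℓ(j)); ℓ(0) is an unused dummy
ℓ : (ℕ → ℕ) → ℕ → ℕ → ℕ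
ℓ L n zero          = 0
ℓ L n (suc zero)    = 1
ℓ L n (suc (suc j)) = nextChange L n (ℓ L n (suc j))

range : ℕ → ℕ → List ℕ
range a zero    = []
range a (suc k) = a ∷ range (suc a) k

runs : (ℕ → ℕ) → ℕ → ℕ
runs L n = suc (length (filter (λ i → ¬? (L i ≟ L (i ∸ 1))) (range 2 (n ∸ 1))))
  where open import Relation.Nullary using (¬?)

rankStart : (ℕ → ℕ) → ℕ → ℕ → ℕ
rankStart L n i = length (filter (λ j → ℓ L n j ≤? i) (range 1 (runs L n)))

L′ : (ℕ → ℕ) → ℕ → ℕ → ℕ
L′ L n j = L (ℓ L n j)

InRD : (ℕ → ℕ) → ℕ → ℕ → ℕ → ℕ → ℕ → Set
InRD S b e c p q =
  (b ≤ p × p ≤ e) × (b ≤ q × q ≤ e) × S p ≡ c × S q ≡ c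
  × (∀ k → b ≤ k → k ≤ e → S k ≡ c → p ≤ k × k ≤ q)

module Submission where

-- Lemma 3 (range-distinct queries on the BWT via its run heads) is a statement
-- about the run decomposition of an arbitrary string L.
--
--  * Blocks: a strictly increasing h : ℕ → ℕ cuts ℕ into blocks
--    [h j, h (j+1)).  Every position lies in exactly one block, and block indices
--    are monotone in positions.  If a string S is constant on every block, then
--    RD(S, b, e) is obtained from RD(S ∘ h, jb, je), jb and je being the blocks of
--    b and e, by clipping each block to [b, e]  (theorem blockwise-RD).
--  * Runs: the run heads ℓ(1) < ℓ(2) < ... of L (computed by a bounded search for
--    the next change of character) are strictly increasing and L is constant on
--    each run, so the block theory applies with h = ℓ.
--  * Ranks: counting the changes of character shows that position i ∈ [1, n] in
--    run j has exactly j − 1 changes in [2, i]; hence the number of runs r is the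
--    run of n, and rank(S_start, i) = j.  Substituting the ranks in
--    blockwise-RD gives the theorem.

open import Defs
open import Data.Nat using (ℕ; zero; suc; _+_; _≤_; _<_; _∸_; _⊔_; _⊓_; _≟_; _≤?_; _<?_; _≡ᵇ_; z≤n; s≤s)
open import Data.Nat.Properties
open import Data.Bool using (true; false; T)
open import Data.Unit using (tt)
open import Data.Empty using (⊥-elim)
open import Data.Product using (_×_; _,_; ∃; proj₁; proj₂)
open import Data.Sum using (_⊎_; inj₁; inj₂)
open import Data.List using ([]; _∷_; _++_; length; filter)
open import Data.List.Properties using (filter-++; length-++; filter-accept; filter-reject)
open import Function.Bundles using (_⇔_; mk⇔; Equivalence)
open import Relation.Nullary using (¬_; yes; no; ¬?)
open import Relation.Unary using (Pred; Decidable)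
open import Relation.Binary.PropositionalEquality using (_≡_; _≢_; refl; sym; trans; cong; subst; module ≡-Reasoning)

<⇒≤∸1 : ∀ {m n} → m < n → m ≤ n ∸ 1
<⇒≤∸1 (s≤s m≤n) = m≤n

∸1< : ∀ {n} → 0 < n → n ∸ 1 < n
∸1< {suc n} _ = n<1+n n

module Blocks (h : ℕ → ℕ) (h-step : ∀ j → h j < h (suc j)) where

  h-mono-< : ∀ {i j} → i < j → h i < h j
  h-mono-< {i} {suc j} (s≤s i≤j) with m≤n⇒m<n∨m≡n i≤j
  ... | inj₁ i<j  = <-trans (h-mono-< i<j) (h-step j)
  ... | inj₂ refl = h-step i

  h-mono : ∀ {i j} → i ≤ j → h i ≤ h j
  h-mono i≤j with m≤n⇒m<n∨m≡n i≤j
  ... | inj₁ i<j  = <⇒≤ (h-mono-< i<j)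
  ... | inj₂ refl = ≤-refl

  h-cancel : ∀ {i j} → h i < h (suc j) → i ≤ j
  h-cancel {i} {j} lt with i ≤? j
  ... | yes i≤j = i≤j
  ... | no  i≰j = ⊥-elim (<⇒≱ lt (h-mono (≰⇒> i≰j)))

  h-inflationary : ∀ j → j ≤ h j
  h-inflationary zero    = z≤n
  h-inflationary (suc j) = ≤-<-trans (h-inflationary j) (h-step j)

  infix 4 _∈Block_
  record _∈Block_ (i j : ℕ) : Set where
    constructor _,_
    field
      start≤ : h j ≤ i
      <end   : i < h (suc j)

  open _∈Block_ public

  block-order : ∀ {i i′ j j′} → i ∈Block j → i′ ∈Block j′ → i ≤ i′ → j ≤ j′
  block-order (hj≤i , _) (_ , i′<h) i≤i′ = h-cancel (≤-<-trans (≤-trans hj≤i i≤i′) i′<h)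

  block-unique : ∀ {i j j′} → i ∈Block j → i ∈Block j′ → j ≡ j′
  block-unique i∈j i∈j′ = ≤-antisym (block-order i∈j i∈j′ ≤-refl) (block-order i∈j′ i∈j ≤-refl)

  block-find : ∀ a m i → h a ≤ i → i < h (suc m) → ∃ λ j → (a ≤ j × j ≤ m) × i ∈Block j
  block-find a m i ha≤i i<h with i <? h m
  ... | no  i≮hm = m , (h-cancel (≤-<-trans ha≤i i<h) , ≤-refl) , (≮⇒≥ i≮hm , i<h)
  block-find a zero i ha≤i i<h | yes i<h0 = ⊥-elim (<⇒≱ i<h0 (≤-trans (h-mono z≤n) ha≤i))
  block-find a (suc m) i ha≤i i<h | yes i<hm with block-find a m i ha≤i i<hm
  ... | j , (a≤j , j≤m) , i∈j = j , (a≤j , m≤n⇒m≤1+n j≤m) , i∈j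

  module BlockConstant (S : ℕ → ℕ) (S-const : ∀ {i j} → i ∈Block j → S i ≡ S (h j))
                       {b e jb je : ℕ} (b≤e : b ≤ e) (b∈jb : b ∈Block jb) (e∈je : e ∈Block je) where

    first last : ℕ → ℕ
    first j = h j ⊔ b
    last  j = (h (suc j) ∸ 1) ⊓ e

    first∈Block : ∀ {j} → jb ≤ j → first j ∈Block j
    first∈Block jb≤j = m≤m⊔n _ _ , ⊔-lub (h-step _) (<-≤-trans (<end b∈jb) (h-mono (s≤s jb≤j)))

    last∈Block : ∀ {j} → j ≤ je → last j ∈Block j
    last∈Block j≤je =
      ⊓-glb (<⇒≤∸1 (h-step _)) (≤-trans (h-mono j≤je) (start≤ e∈je)) ,
      ≤-<-trans (m⊓n≤m _ _) (∸1< (≤-<-trans z≤n (h-step _)))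

    first∈range : ∀ {j} → j ≤ je → b ≤ first j × first j ≤ e
    first∈range j≤je = m≤n⊔m _ _ , ⊔-lub (≤-trans (h-mono j≤je) (start≤ e∈je)) b≤e

    last∈range : ∀ {j} → jb ≤ j → b ≤ last j × last j ≤ e
    last∈range jb≤j = ⊓-glb (<⇒≤∸1 (<-≤-trans (<end b∈jb) (h-mono (s≤s jb≤j)))) b≤e , m⊓n≤n _ _

    first≤ : ∀ {i j} → i ∈Block j → b ≤ i → first j ≤ i
    first≤ (hj≤i , _) b≤i = ⊔-lub hj≤i b≤i

    ≤last : ∀ {i j} → i ∈Block j → i ≤ e → i ≤ last j
    ≤last (_ , i<h) i≤e = ⊓-glb (<⇒≤∸1 i<h) i≤e

    locate : ∀ {i} → b ≤ i → i ≤ e → ∃ λ j → (jb ≤ j × j ≤ je) × i ∈Block j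
    locate {i} b≤i i≤e = block-find jb je i (≤-trans (start≤ b∈jb) b≤i) (≤-<-trans i≤e (<end e∈je))

    S-first : ∀ {j} → jb ≤ j → S (first j) ≡ S (h j)
    S-first jb≤j = S-const (first∈Block jb≤j)

    S-last : ∀ {j} → j ≤ je → S (last j) ≡ S (h j)
    S-last j≤je = S-const (last∈Block j≤je)

    BlockRD : ℕ → ℕ → ℕ → Set
    BlockRD c p q = ∃ λ p′ → ∃ λ q′ → InRD (λ j → S (h j)) jb je c p′ q′ × p ≡ first p′ × q ≡ last q′

    -- An extreme occurrence of c in [b, e] is the clipped end of the extreme
    -- block carrying c.
    RD⇒BlockRD : ∀ c p q → InRD S b e c p q → BlockRD c p q
    RD⇒BlockRD c p q ((b≤p , p≤e) , (b≤q , q≤e) , Sp≡c , Sq≡c , extreme) with locate b≤p p≤e | locate b≤q q≤e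
    ... | jp , (jb≤jp , jp≤je) , p∈jp | jq , (jb≤jq , jq≤je) , q∈jq =
      jp , jq , ((jb≤jp , jp≤je) , (jb≤jq , jq≤je) , head-p , head-q , block-extreme) , p≡first , q≡last
      where
      head-p : S (h jp) ≡ c
      head-p = trans (sym (S-const p∈jp)) Sp≡c

      head-q : S (h jq) ≡ c
      head-q = trans (sym (S-const q∈jq)) Sq≡c

      -- A block k carrying c contributes occurrences first k and last k.
      block-extreme : ∀ k → jb ≤ k → k ≤ je → S (h k) ≡ c → jp ≤ k × k ≤ jq
      block-extreme k jb≤k k≤je Shk≡c =
        block-order p∈jp (first∈Block jb≤k)
          (proj₁ (extreme (first k) (proj₁ (first∈range k≤je)) (proj₂ (first∈range k≤je)) (trans (S-first jb≤k) Shk≡c))) ,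
        block-order (last∈Block k≤je) q∈jq
          (proj₂ (extreme (last k) (proj₁ (last∈range jb≤k)) (proj₂ (last∈range jb≤k)) (trans (S-last k≤je) Shk≡c)))

      p≡first : p ≡ first jp
      p≡first = ≤-antisym
        (proj₁ (extreme (first jp) (proj₁ (first∈range jp≤je)) (proj₂ (first∈range jp≤je)) (trans (S-first jb≤jp) head-p)))
        (first≤ p∈jp b≤p)

      q≡last : q ≡ last jq
      q≡last = ≤-antisym
        (≤last q∈jq q≤e)
        (proj₂ (extreme (last jq) (proj₁ (last∈range jb≤jq)) (proj₂ (last∈range jb≤jq)) (trans (S-last jq≤je) head-q)))

    BlockRD⇒RD : ∀ c p′ q′ → InRD (λ j → S (h j)) jb je c p′ q′ → InRD S b e c (first p′) (last q′)
    BlockRD⇒RD c p′ q′ ((jb≤p′ , p′≤je) , (jb≤q′ , q′≤je) , Shp′≡c , Shq′≡c , block-extreme) =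
      first∈range p′≤je , last∈range jb≤q′ , trans (S-first jb≤p′) Shp′≡c , trans (S-last q′≤je) Shq′≡c , extreme
      where
      extreme : ∀ k → b ≤ k → k ≤ e → S k ≡ c → first p′ ≤ k × k ≤ last q′
      extreme k b≤k k≤e Sk≡c with locate b≤k k≤e
      ... | j , (jb≤j , j≤je) , k∈j with block-extreme j jb≤j j≤je (trans (sym (S-const k∈j)) Sk≡c)
      ... | p′≤j , j≤q′ =
        ⊔-lub (≤-trans (h-mono p′≤j) (start≤ k∈j)) b≤k ,
        ⊓-glb (<⇒≤∸1 (<-≤-trans (<end k∈j) (h-mono (s≤s j≤q′)))) k≤e

    blockwise-RD : ∀ c p q → InRD S b e c p q ⇔ BlockRD c p q
    blockwise-RD c p q = mk⇔ (RD⇒BlockRD c p q) from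
      where
      from : BlockRD c p q → InRD S b e c p q
      from (p′ , q′ , rd′ , refl , refl) = BlockRD⇒RD c p′ q′ rd′

constant-from : ∀ (S : ℕ → ℕ) a b → (∀ i → a < i → i < b → S i ≡ S (i ∸ 1)) →
                ∀ i → a ≤ i → i < b → S i ≡ S a
constant-from S a b repeats zero    a≤0   _   = cong S (sym (n≤0⇒n≡0 a≤0))
constant-from S a b repeats (suc i) a≤1+i 1+i<b with m≤n⇒m<n∨m≡n a≤1+i
... | inj₁ a<1+i = trans (repeats (suc i) a<1+i 1+i<b) (constant-from S a b repeats i (≤-pred a<1+i) (<-trans (n<1+n i) 1+i<b))
... | inj₂ refl  = refl

range-snoc : ∀ a k → range a (suc k) ≡ range a k ++ (a + k ∷ [])
range-snoc a zero    = cong (_∷ []) (sym (+-identityʳ a))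
range-snoc a (suc k) = cong (a ∷_) (trans (range-snoc (suc a) k) (cong (λ z → range (suc a) k ++ (z ∷ [])) (sym (+-suc a k))))

module _ {p} {P : Pred ℕ p} (P? : Decidable P) where

  count-none : ∀ m a → (∀ x → a ≤ x → ¬ P x) → length (filter P? (range a m)) ≡ 0
  count-none zero    a none = refl
  count-none (suc m) a none =
    trans (cong length (filter-reject P? (none a ≤-refl))) (count-none m (suc a) (λ x a<x → none x (<⇒≤ a<x)))

  count-prefix : ∀ m a t → t ≤ m → (∀ x → a ≤ x → P x ⇔ x < a + t) → length (filter P? (range a m)) ≡ t
  count-prefix m a zero _ prefix =
    count-none m a (λ x a≤x Px → <⇒≱ (Equivalence.to (prefix x a≤x) Px) (≤-trans (≤-reflexive (+-identityʳ a)) a≤x))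
  count-prefix (suc m) a (suc t) (s≤s t≤m) prefix =
    trans (cong length (filter-accept P? (Equivalence.from (prefix a ≤-refl) a<a+1+t)))
          (cong suc (count-prefix m (suc a) t t≤m prefix′))
    where
    a<a+1+t : a < a + suc t
    a<a+1+t = ≤-trans (s≤s (m≤m+n a t)) (≤-reflexive (sym (+-suc a t)))

    prefix′ : ∀ x → suc a ≤ x → P x ⇔ x < suc a + t
    prefix′ x a<x = subst (λ y → P x ⇔ x < y) (+-suc a t) (prefix x (<⇒≤ a<x))

search-step : ∀ L f k →
  (L k ≡ L (k ∸ 1) × search L (suc f) k ≡ search L f (suc k)) ⊎
  (L k ≢ L (k ∸ 1) × search L (suc f) k ≡ k)
search-step L f k with L k ≡ᵇ L (k ∸ 1) in eq
... | true  = inj₁ (≡ᵇ⇒≡ (L k) (L (k ∸ 1)) (subst T (sym eq) tt) , refl)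
... | false = inj₂ ((λ same → subst T eq (≡⇒≡ᵇ (L k) (L (k ∸ 1)) same)) , refl)

search-≥ : ∀ L f k → k ≤ search L f k
search-≥ L zero    k = ≤-refl
search-≥ L (suc f) k with search-step L f k
... | inj₁ (_ , eq) rewrite eq = ≤-trans (n≤1+n k) (search-≥ L f (suc k))
... | inj₂ (_ , eq) rewrite eq = ≤-refl

search-skips-repeats : ∀ L f k i → k ≤ i → i < search L f k → L i ≡ L (i ∸ 1)
search-skips-repeats L zero k i k≤i i<k = ⊥-elim (<⇒≱ i<k k≤i)
search-skips-repeats L (suc f) k i k≤i i<s with search-step L f k
... | inj₂ (_ , eq) rewrite eq = ⊥-elim (<⇒≱ i<s k≤i)
... | inj₁ (repeat , eq) rewrite eq with m≤n⇒m<n∨m≡n k≤i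
...   | inj₁ k<i  = search-skips-repeats L f (suc k) i k<i i<s
...   | inj₂ refl = repeat

search-stops-at-change : ∀ L f k → search L f k < k + f → L (search L f k) ≢ L (search L f k ∸ 1)
search-stops-at-change L zero    k lt = ⊥-elim (<-irrefl (sym (+-identityʳ k)) lt)
search-stops-at-change L (suc f) k lt with search-step L f k
... | inj₁ (_ , eq) rewrite eq = search-stops-at-change L f (suc k) (subst (search L f (suc k) <_) (+-suc k f) lt)
... | inj₂ (change , eq) rewrite eq = change

-- The runs of a string L of length n.  Block j of the run heads ℓ(j) is run j
-- (block 0 is the dummy position 0).
module Runs (L : ℕ → ℕ) (n : ℕ) where

  head : ℕ → ℕ
  head = ℓ L n

  head-step : ∀ j → head j < head (suc j)
  head-step zero    = s≤s z≤n
  head-step (suc j) = search-≥ L (n ∸ head (suc j)) (suc (head (suc j)))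

  open Blocks head head-step

  -- The run containing position i (ℓ(0) = 0 ≤ i and i < ℓ(i+1)).
  run : ℕ → ℕ
  run i = proj₁ (block-find 0 i i z≤n (h-inflationary (suc i)))

  ∈run : ∀ i → i ∈Block run i
  ∈run i = proj₂ (proj₂ (block-find 0 i i z≤n (h-inflationary (suc i))))

  repeats-in-run : ∀ {i j} → i ∈Block j → head j < i → L i ≡ L (i ∸ 1)
  repeats-in-run {j = zero}  (_ , i<1) 0<i = ⊥-elim (<⇒≱ i<1 0<i)
  repeats-in-run {i} {suc j} (_ , i<h) h<i = search-skips-repeats L (n ∸ head (suc j)) (suc (head (suc j))) i h<i i<h

  run-constant : ∀ {i j} → i ∈Block j → L i ≡ L (head j)
  run-constant {i} {j} (hj≤i , i<h) =
    constant-from L (head j) (head (suc j)) (λ k hj<k k<h → repeats-in-run {j = j} (<⇒≤ hj<k , k<h) hj<k) i hj≤i i<h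

  change-at-head : ∀ j → 1 ≤ j → head (suc j) ≤ n → L (head (suc j)) ≢ L (head (suc j) ∸ 1)
  change-at-head (suc j) _ next≤n =
    search-stops-at-change L (n ∸ p) (suc p) (subst (head (suc (suc j)) <_) (sym (cong suc (m+[n∸m]≡n p≤n))) (s≤s next≤n))
    where
    p : ℕ
    p = head (suc j)

    p≤n : p ≤ n
    p≤n = <⇒≤ (<-≤-trans (head-step (suc j)) next≤n)

  repeat-stays-in-run : ∀ {x j} → 1 ≤ j → suc x ≤ n → x ∈Block j → L (suc x) ≡ L x → suc x ∈Block j
  repeat-stays-in-run {x} {j} 1≤j 1+x≤n (hj≤x , x<h) repeat with suc x <? head (suc j)
  ... | yes 1+x<h = m≤n⇒m≤1+n hj≤x , 1+x<h
  ... | no  1+x≮h = ⊥-elim (change-at-head j 1≤j (subst (_≤ n) 1+x≡h 1+x≤n)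
                              (subst (λ y → L y ≡ L (y ∸ 1)) 1+x≡h repeat))
    where
    1+x≡h : suc x ≡ head (suc j)
    1+x≡h = ≤-antisym x<h (≮⇒≥ 1+x≮h)

  change-starts-next-run : ∀ {x j} → x ∈Block j → L (suc x) ≢ L x → suc x ∈Block (suc j)
  change-starts-next-run {x} {j} (hj≤x , x<h) change with suc x <? head (suc j)
  ... | yes 1+x<h = ⊥-elim (change (repeats-in-run {j = j} (m≤n⇒m≤1+n hj≤x , 1+x<h) (s≤s hj≤x)))
  ... | no  1+x≮h = ≮⇒≥ 1+x≮h , ≤-<-trans x<h (head-step (suc j))

  Change? : Decidable (λ k → L k ≢ L (k ∸ 1))
  Change? k = ¬? (L k ≟ L (k ∸ 1))

  changes : ℕ → ℕ
  changes x = length (filter Change? (range 2 (x ∸ 1)))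

  changes-snoc : ∀ y → changes (2 + y) ≡ changes (1 + y) + length (filter Change? (2 + y ∷ []))
  changes-snoc y = begin
    length (filter Change? (range 2 (suc y)))                              ≡⟨ cong (λ xs → length (filter Change? xs)) (range-snoc 2 y) ⟩
    length (filter Change? (range 2 y ++ (2 + y ∷ [])))                     ≡⟨ cong length (filter-++ Change? (range 2 y) (2 + y ∷ [])) ⟩
    length (filter Change? (range 2 y) ++ filter Change? (2 + y ∷ []))      ≡⟨ length-++ (filter Change? (range 2 y)) ⟩
    changes (1 + y) + length (filter Change? (2 + y ∷ []))                  ∎
    where open ≡-Reasoning

  changes-repeat : ∀ x → 1 ≤ x → L (suc x) ≡ L x → changes (suc x) ≡ changes x
  changes-repeat (suc y) _ repeat = begin
    changes (2 + y)                                            ≡⟨ changes-snoc y ⟩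
    changes (1 + y) + length (filter Change? (2 + y ∷ []))     ≡⟨ cong (λ xs → changes (1 + y) + length xs) (filter-reject Change? (λ change → change repeat)) ⟩
    changes (1 + y) + 0                                        ≡⟨ +-identityʳ _ ⟩
    changes (1 + y)                                            ∎
    where open ≡-Reasoning

  changes-change : ∀ x → 1 ≤ x → L (suc x) ≢ L x → changes (suc x) ≡ suc (changes x)
  changes-change (suc y) _ change = begin
    changes (2 + y)                                            ≡⟨ changes-snoc y ⟩
    changes (1 + y) + length (filter Change? (2 + y ∷ []))     ≡⟨ cong (λ xs → changes (1 + y) + length xs) (filter-accept Change? change) ⟩
    changes (1 + y) + 1                                        ≡⟨ +-comm _ 1 ⟩
    suc (changes (1 + y))                                      ∎
    where open ≡-Reasoning

  changes-step : ∀ y {j₀ j} → 2 + y ≤ n → 1 + y ∈Block j₀ → 2 + y ∈Block j →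
                 suc (changes (1 + y)) ≡ j₀ → suc (changes (2 + y)) ≡ j
  changes-step y {j₀} {j} x+1≤n x∈j₀ x+1∈j ih with L (2 + y) ≟ L (1 + y)
  ... | yes repeat = begin
    suc (changes (2 + y))  ≡⟨ cong suc (changes-repeat (suc y) (s≤s z≤n) repeat) ⟩
    suc (changes (1 + y))  ≡⟨ ih ⟩
    j₀                     ≡⟨ block-unique (repeat-stays-in-run (subst (1 ≤_) ih (s≤s z≤n)) x+1≤n x∈j₀ repeat) x+1∈j ⟩
    j                      ∎
    where open ≡-Reasoning
  ... | no change = begin
    suc (changes (2 + y))       ≡⟨ cong suc (changes-change (suc y) (s≤s z≤n) change) ⟩
    suc (suc (changes (1 + y))) ≡⟨ cong suc ih ⟩
    suc j₀                      ≡⟨ block-unique (change-starts-next-run x∈j₀ change) x+1∈j ⟩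
    j                           ∎
    where open ≡-Reasoning

  changes-in-run : ∀ i {j} → 1 ≤ i → i ≤ n → i ∈Block j → suc (changes i) ≡ j
  changes-in-run (suc zero)    _ _   1∈j = block-unique {j = 1} (≤-refl , head-step 1) 1∈j
  changes-in-run (suc (suc y)) _ i≤n i∈j =
    changes-step y i≤n (∈run (suc y)) i∈j (changes-in-run (suc y) (s≤s z≤n) (<⇒≤ i≤n) (∈run (suc y)))

  rank-is-run : ∀ {i j} → 1 ≤ i → i ≤ n → i ∈Block j → rankStart L n i ≡ j
  rank-is-run {i} {j} 1≤i i≤n i∈j = count-prefix (λ k → head k ≤? i) (runs L n) 1 j j≤r heads-below-i
    where
    j≤r : j ≤ runs L n
    j≤r = subst (j ≤_) (sym (changes-in-run n (≤-trans 1≤i i≤n) ≤-refl (∈run n))) (block-order i∈j (∈run n) i≤n)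

    heads-below-i : ∀ k → 1 ≤ k → head k ≤ i ⇔ k < suc j
    heads-below-i k _ = mk⇔ (λ hk≤i → s≤s (h-cancel (≤-<-trans hk≤i (<end i∈j))))
                            (λ k<1+j → ≤-trans (h-mono (≤-pred k<1+j)) (start≤ i∈j))

  runs-RD : ∀ {b e} → 1 ≤ b → b ≤ e → e ≤ n → ∀ c p q →
            InRD L b e c p q
            ⇔ (∃ λ p′ → ∃ λ q′ →
                 InRD (L′ L n) (rankStart L n b) (rankStart L n e) c p′ q′
                 × p ≡ ℓ L n p′ ⊔ b
                 × q ≡ (ℓ L n (suc q′) ∸ 1) ⊓ e)
  runs-RD {b} {e} 1≤b b≤e e≤n
    rewrite rank-is-run 1≤b (≤-trans b≤e e≤n) (∈run b) | rank-is-run (≤-trans 1≤b b≤e) e≤n (∈run e) =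
    BlockConstant.blockwise-RD L run-constant b≤e (∈run b) (∈run e)

lemma3 : (σ n : ℕ) (T SA : ℕ → ℕ) → ValidText σ n T → IsSA n T SA →
         (b e : ℕ) → 1 ≤ b → b ≤ e → e ≤ n →
         ∀ c p q →
           InRD (BWT n T SA) b e c p q
           ⇔ (∃ λ p′ → ∃ λ q′ →
                InRD (L′ (BWT n T SA) n) (rankStart (BWT n T SA) n b) (rankStart (BWT n T SA) n e) c p′ q′
                × p ≡ ℓ (BWT n T SA) n p′ ⊔ b
                × q ≡ (ℓ (BWT n T SA) n (suc q′) ∸ 1) ⊓ e)
lemma3 σ n T SA _ _ _ _ = Runs.runs-RD (BWT n T SA) n
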